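{- (1) Each of the relations $\to^{\mathsf s}_{\beta_c}$, $\to^{\mathsf s}_{\mathsf{id}}$, $\to^{\mathsf s}_{\sigma}$ is confluent. (2) $\to^{\mathsf s}_{\beta_c}\cup\to^{\mathsf s}_{\mathsf{id}}$ and $\to^{\mathsf s}_{\beta_c}\cup\to^{\mathsf s}_{\sigma}$ are confluent. (3) $\to^{\mathsf s}_{\beta_c}\cup\to^{\mathsf s}_{\sigma}\cup\to^{\mathsf s}_{\mathsf{id}}$ is confluent. (4) $\to^{\mathsf s}_{\sigma}\cup\to^{\mathsf s}_{\mathsf{id}}$ is not confluent.
   Context: The computational core $\lambda_{\copyright}$ has values $V,W ::= x \mid \lambda x.M$ and computations $M,N,L ::= \,!V \mid VM$ ($x$ ranging over a countable set of variables, terms up to $\alpha$-renaming). Rules on computations: $\beta_c$: $(\lambda x.M)(!V) \mapsto M\{V/x\}$; $\mathsf{id}$: $(\lambda x.!x)M \mapsto M$; $\sigma$: $(\lambda y.N)((\lambda x.M)L) \mapsto (\lambda x.(\lambda y.N)M)L$ provided $x\notin \mathrm{fv}(N)$. Surface contexts $S ::= [\,]\mid VS\mid(\lambda x.S)M$ (hole filled by a computation); $\to^{\mathsf s}_\rho$ is the closure of rule $\rho$ under surface contexts. A relation $\to$ is confluent if whenever $M\to^* N_1$ and $M\to^* N_2$ there is $P$ with $N_1\to^*P$ and $N_2\to^*P$. -}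

module Defs where

open import Data.Nat using (ℕ; zero; suc)
open import Relation.Binary.Core using (Rel)
open import Level using (0ℓ)

-- Syntax of the computational core λ©, with de Bruijn indices
-- (terms up to α-renaming).
mutual
  data Val : Set where
    var : ℕ → Val
    lam : Comp → Val

  data Comp : Set where
    ret : Val → Comp        -- !V
    app : Val → Comp → Comp

ext : (ℕ → ℕ) → ℕ → ℕ
ext ρ zero    = zero
ext ρ (suc n) = suc (ρ n)

mutual
  renV : (ℕ → ℕ) → Val → Val
  renV ρ (var n) = var (ρ n)
  renV ρ (lam M) = lam (renC (ext ρ) M)

  renC : (ℕ → ℕ) → Comp → Comp
  renC ρ (ret V)   = ret (renV ρ V)
  renC ρ (app V M) = app (renV ρ V) (renC ρ M)

exts : (ℕ → Val) → ℕ → Val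
exts σ zero    = var zero
exts σ (suc n) = renV suc (σ n)

mutual
  substV : (ℕ → Val) → Val → Val
  substV σ (var n) = σ n
  substV σ (lam M) = lam (substC (exts σ) M)

  substC : (ℕ → Val) → Comp → Comp
  substC σ (ret V)   = ret (substV σ V)
  substC σ (app V M) = app (substV σ V) (substC σ M)

single : Val → ℕ → Val
single V zero    = V
single V (suc n) = var n

-- M{V/x}, where x is the variable bound at index 0 of M
_[_] : Comp → Val → Comp
M [ V ] = substC (single V) M

data βc : Rel Comp 0ℓ where
  βc-rule : ∀ M V → βc (app (lam M) (ret V)) (M [ V ])

data idr : Rel Comp 0ℓ where
  id-rule : ∀ M → idr (app (lam (ret (var zero))) M) M

-- σ : (λy.N)((λx.M)L) ↦ (λx.(λy.N)M)L, x ∉ fv(N)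
-- (with de Bruijn indices, λy.N is weakened past the new binder x,
--  which makes the freshness side condition automatic)
data σr : Rel Comp 0ℓ where
  σ-rule : ∀ N M L →
    σr (app (lam N) (app (lam M) L))
       (app (lam (app (renV suc (lam N)) M)) L)

data Surf (R : Rel Comp 0ℓ) : Rel Comp 0ℓ where
  root  : ∀ {M N} → R M N → Surf R M N
  appR  : ∀ {M N} V → Surf R M N → Surf R (app V M) (app V N)
  lamL  : ∀ {M N} L → Surf R M N → Surf R (app (lam M) L) (app (lam N) L)

-- For βc and id every one-step peak closes in at most
-- one step on each side (strong confluence), and σ is terminating and locally confluent,
-- so Newman's lemma applies. The unions follow by Hindley–Rosen once the rules are shown
-- to commute, again from one-step peaks: a σ-step against a βc- or id-step closes with at
-- most one σ-step on one side. The one exception is the root peak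
-- (λy.N)L ← (λy.N)((λx.!x)L) → (λx.(λy.N)(!x))L of id against σ, which needs a βc-step;
-- without βc it yields the counterexample for σ ∪ id.
module Submission where

open import Defs
open import Data.Product using (_×_)
open import Relation.Nullary using (¬_)
open import Relation.Binary.Construct.Union using (_∪_)
open import Relation.Binary.Rewriting using (Confluent)

open import Level using (Level; 0ℓ)
open import Data.Nat using (ℕ; zero; suc; _+_; _<_; _≤_)
open import Data.Nat.Properties
  using (<-trans; ≤-refl; ≤-trans; m≤m+n; m<m+n; +-mono-<; +-monoˡ-<; +-monoʳ-<)
open import Data.Nat.Induction using (<-wellFounded)
open import Data.Nat.Tactic.RingSolver using (solve-∀)
open import Data.Product using (∃; _,_; -,_; map₂; swap)
open import Data.Sum as Sum using (inj₁; inj₂)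
open import Function using (_∘_)
open import Induction.WellFounded using (module Subrelation)
open import Relation.Binary.Core using (Rel; _⇒_)
open import Relation.Binary.PropositionalEquality hiding ([_])
open import Relation.Binary.Rewriting using (IsNormalForm; WeaklyConfluent; StronglyNormalizing; sn&wcr⇒cr)
open import Relation.Binary.Construct.Closure.Reflexive as Refl using (ReflClosure)
open import Relation.Binary.Construct.Closure.ReflexiveTransitive as Star
  using (Star; ε; _◅_; _◅◅_; return; _⋆)
import Relation.Binary.Construct.Closure.Transitive as Plus
import Relation.Binary.Construct.On as On

private
  variable
    a ℓ ℓ₁ ℓ₂ : Level
    A : Set a

Joinable : Rel A ℓ₁ → Rel A ℓ₂ → A → A → Set _
Joinable X Y b c = ∃ λ d → X b d × Y c d

Commute : Rel A ℓ₁ → Rel A ℓ₂ → Set _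
Commute S R = ∀ {m b c} → Star S m b → Star R m c → Joinable (Star R) (Star S) b c

StronglyCommute : Rel A ℓ₁ → Rel A ℓ₂ → Set _
StronglyCommute S R = ∀ {m b c} → S m b → R m c → Joinable (Star R) (ReflClosure S) b c

refl⇒star : {R : Rel A ℓ} → ReflClosure R ⇒ Star R
refl⇒star Refl.refl  = ε
refl⇒star Refl.[ r ] = return r

module _ {S : Rel A ℓ₁} {R : Rel A ℓ₂} where

  strongly-commute-from-refl :
    (∀ {m b c} → S m b → R m c → Joinable (ReflClosure R) (ReflClosure S) b c) →
    StronglyCommute S R
  strongly-commute-from-refl peak s r = map₂ (λ (rs , s⁼) → refl⇒star rs , s⁼) (peak s r)

  strong⇒strip : StronglyCommute S R →
    ∀ {m b c} → S m b → Star R m c → Joinable (Star R) (ReflClosure S) b c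
  strong⇒strip sc s ε = -, ε , Refl.[ s ]
  strong⇒strip sc s (r ◅ rs) with sc s r
  ... | _ , bd , Refl.refl = -, bd ◅◅ rs , Refl.refl
  ... | _ , bd , Refl.[ s′ ] with strong⇒strip sc s′ rs
  ...   | _ , de , e⁼ = -, bd ◅◅ de , e⁼

  strong⇒commute : StronglyCommute S R → Commute S R
  strong⇒commute sc ε rs = -, rs , ε
  strong⇒commute sc (s ◅ ss) rs with strong⇒strip sc s rs
  ... | _ , bd , d⁼ with strong⇒commute sc ss bd
  ...   | _ , b′e , de = -, b′e , refl⇒star d⁼ ◅◅ de

strong⇒confluent : {R : Rel A ℓ} → StronglyCommute R R → Confluent R
strong⇒confluent = strong⇒commute

confluent-transfer : {R : Rel A ℓ₁} {S : Rel A ℓ₂} →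
  R ⇒ Star S → S ⇒ Star R → Confluent R → Confluent S
confluent-transfer R⊆S* S⊆R* conf bs cs with conf ((S⊆R* ⋆) bs) ((S⊆R* ⋆) cs)
... | d , bd , cd = d , (R⊆S* ⋆) bd , (R⊆S* ⋆) cd

-- The union of the two multi-step relations has the diamond property.
hindley-rosen : {R S : Rel A ℓ} → Confluent R → Confluent S → Commute S R → Confluent (R ∪ S)
hindley-rosen {R = R} {S} confR confS comm =
  confluent-transfer Sum.[ Star.map inj₁ , Star.map inj₂ ] lift (strong⇒confluent diamond)
  where
  diamond : StronglyCommute (Star R ∪ Star S) (Star R ∪ Star S)
  diamond (inj₁ b) (inj₁ c) = let d , bd , cd = confR b c in d , return (inj₁ bd) , Refl.[ inj₁ cd ]
  diamond (inj₂ b) (inj₂ c) = let d , bd , cd = confS b c in d , return (inj₂ bd) , Refl.[ inj₂ cd ]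
  diamond (inj₂ b) (inj₁ c) = let d , bd , cd = comm b c in d , return (inj₁ bd) , Refl.[ inj₂ cd ]
  diamond (inj₁ b) (inj₂ c) = let d , cd , bd = comm c b in d , return (inj₂ bd) , Refl.[ inj₁ cd ]

  lift : R ∪ S ⇒ Star (Star R ∪ Star S)
  lift (inj₁ r) = return (inj₁ (return r))
  lift (inj₂ s) = return (inj₂ (return s))

measure⇒sn : {R : Rel A ℓ} (f : A → ℕ) → (∀ {x y} → R x y → f y < f x) →
  StronglyNormalizing (Plus.Plus R)
measure⇒sn {R = R} f decreasing = Subrelation.wellFounded decreasing⁺ (On.wellFounded f <-wellFounded)
  where
  decreasing⁺ : ∀ {x y} → Plus.Plus R y x → f x < f y
  decreasing⁺ Plus.[ r ]         = decreasing r
  decreasing⁺ (_ Plus.∼⁺⟨ p ⟩ q) = <-trans (decreasing⁺ q) (decreasing⁺ p)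

ext-cong : ∀ {ρ ρ′} → ρ ≗ ρ′ → ext ρ ≗ ext ρ′
ext-cong e zero    = refl
ext-cong e (suc n) = cong suc (e n)

mutual
  renV-cong : ∀ {ρ ρ′} → ρ ≗ ρ′ → ∀ V → renV ρ V ≡ renV ρ′ V
  renV-cong e (var n) = cong var (e n)
  renV-cong e (lam M) = cong lam (renC-cong (ext-cong e) M)

  renC-cong : ∀ {ρ ρ′} → ρ ≗ ρ′ → ∀ M → renC ρ M ≡ renC ρ′ M
  renC-cong e (ret V)   = cong ret (renV-cong e V)
  renC-cong e (app V M) = cong₂ app (renV-cong e V) (renC-cong e M)

ext-∘ : ∀ ρ ρ′ → ext ρ ∘ ext ρ′ ≗ ext (ρ ∘ ρ′)
ext-∘ ρ ρ′ zero    = refl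
ext-∘ ρ ρ′ (suc n) = refl

mutual
  renV-renV : ∀ ρ ρ′ V → renV ρ (renV ρ′ V) ≡ renV (ρ ∘ ρ′) V
  renV-renV ρ ρ′ (var n) = refl
  renV-renV ρ ρ′ (lam M) = cong lam (trans (renC-renC (ext ρ) (ext ρ′) M) (renC-cong (ext-∘ ρ ρ′) M))

  renC-renC : ∀ ρ ρ′ M → renC ρ (renC ρ′ M) ≡ renC (ρ ∘ ρ′) M
  renC-renC ρ ρ′ (ret V)   = cong ret (renV-renV ρ ρ′ V)
  renC-renC ρ ρ′ (app V M) = cong₂ app (renV-renV ρ ρ′ V) (renC-renC ρ ρ′ M)

exts-cong : ∀ {σ σ′} → σ ≗ σ′ → exts σ ≗ exts σ′
exts-cong e zero    = refl
exts-cong e (suc n) = cong (renV suc) (e n)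

mutual
  substV-cong : ∀ {σ σ′} → σ ≗ σ′ → ∀ V → substV σ V ≡ substV σ′ V
  substV-cong e (var n) = e n
  substV-cong e (lam M) = cong lam (substC-cong (exts-cong e) M)

  substC-cong : ∀ {σ σ′} → σ ≗ σ′ → ∀ M → substC σ M ≡ substC σ′ M
  substC-cong e (ret V)   = cong ret (substV-cong e V)
  substC-cong e (app V M) = cong₂ app (substV-cong e V) (substC-cong e M)

exts-var∘ : ∀ ρ → exts (var ∘ ρ) ≗ var ∘ ext ρ
exts-var∘ ρ zero    = refl
exts-var∘ ρ (suc n) = refl

mutual
  renV≡substV : ∀ ρ V → renV ρ V ≡ substV (var ∘ ρ) V
  renV≡substV ρ (var n) = refl
  renV≡substV ρ (lam M) = cong lam (trans (renC≡substC (ext ρ) M) (sym (substC-cong (exts-var∘ ρ) M)))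

  renC≡substC : ∀ ρ M → renC ρ M ≡ substC (var ∘ ρ) M
  renC≡substC ρ (ret V)   = cong ret (renV≡substV ρ V)
  renC≡substC ρ (app V M) = cong₂ app (renV≡substV ρ V) (renC≡substC ρ M)

exts-ext : ∀ σ ρ → exts σ ∘ ext ρ ≗ exts (σ ∘ ρ)
exts-ext σ ρ zero    = refl
exts-ext σ ρ (suc n) = refl

mutual
  substV-renV : ∀ σ ρ V → substV σ (renV ρ V) ≡ substV (σ ∘ ρ) V
  substV-renV σ ρ (var n) = refl
  substV-renV σ ρ (lam M) = cong lam (trans (substC-renC (exts σ) (ext ρ) M) (substC-cong (exts-ext σ ρ) M))

  substC-renC : ∀ σ ρ M → substC σ (renC ρ M) ≡ substC (σ ∘ ρ) M
  substC-renC σ ρ (ret V)   = cong ret (substV-renV σ ρ V)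
  substC-renC σ ρ (app V M) = cong₂ app (substV-renV σ ρ V) (substC-renC σ ρ M)

ext-exts : ∀ ρ σ → renV (ext ρ) ∘ exts σ ≗ exts (renV ρ ∘ σ)
ext-exts ρ σ zero    = refl
ext-exts ρ σ (suc n) = trans (renV-renV (ext ρ) suc (σ n)) (sym (renV-renV suc ρ (σ n)))

mutual
  renV-substV : ∀ ρ σ V → renV ρ (substV σ V) ≡ substV (renV ρ ∘ σ) V
  renV-substV ρ σ (var n) = refl
  renV-substV ρ σ (lam M) = cong lam (trans (renC-substC (ext ρ) (exts σ) M) (substC-cong (ext-exts ρ σ) M))

  renC-substC : ∀ ρ σ M → renC ρ (substC σ M) ≡ substC (renV ρ ∘ σ) M
  renC-substC ρ σ (ret V)   = cong ret (renV-substV ρ σ V)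
  renC-substC ρ σ (app V M) = cong₂ app (renV-substV ρ σ V) (renC-substC ρ σ M)

exts-exts : ∀ σ τ → substV (exts σ) ∘ exts τ ≗ exts (substV σ ∘ τ)
exts-exts σ τ zero    = refl
exts-exts σ τ (suc n) = trans (substV-renV (exts σ) suc (τ n)) (sym (renV-substV suc σ (τ n)))

mutual
  substV-substV : ∀ σ τ V → substV σ (substV τ V) ≡ substV (substV σ ∘ τ) V
  substV-substV σ τ (var n) = refl
  substV-substV σ τ (lam M) = cong lam (trans (substC-substC (exts σ) (exts τ) M) (substC-cong (exts-exts σ τ) M))

  substC-substC : ∀ σ τ M → substC σ (substC τ M) ≡ substC (substV σ ∘ τ) M
  substC-substC σ τ (ret V)   = cong ret (substV-substV σ τ V)
  substC-substC σ τ (app V M) = cong₂ app (substV-substV σ τ V) (substC-substC σ τ M)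

exts-var : exts var ≗ var
exts-var zero    = refl
exts-var (suc n) = refl

mutual
  substV-var : ∀ V → substV var V ≡ V
  substV-var (var n) = refl
  substV-var (lam M) = cong lam (trans (substC-cong exts-var M) (substC-var M))

  substC-var : ∀ M → substC var M ≡ M
  substC-var (ret V)   = cong ret (substV-var V)
  substC-var (app V M) = cong₂ app (substV-var V) (substC-var M)

substC-[] : ∀ σ M V → substC σ (M [ V ]) ≡ substC (exts σ) M [ substV σ V ]
substC-[] σ M V = trans (substC-substC σ (single V) M)
                    (trans (substC-cong pointwise M) (sym (substC-substC (single (substV σ V)) (exts σ) M)))
  where
  pointwise : substV σ ∘ single V ≗ substV (single (substV σ V)) ∘ exts σ
  pointwise zero    = refl
  pointwise (suc n) = sym (trans (substV-renV (single (substV σ V)) suc (σ n)) (substV-var (σ n)))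

renV-ext-wk : ∀ ρ V → renV (ext ρ) (renV suc V) ≡ renV suc (renV ρ V)
renV-ext-wk ρ V = trans (renV-renV (ext ρ) suc V) (sym (renV-renV suc ρ V))

substV-exts-wk : ∀ σ V → substV (exts σ) (renV suc V) ≡ renV suc (substV σ V)
substV-exts-wk σ V = trans (substV-renV (exts σ) suc V) (sym (renV-substV suc σ V))

substV-single-wk : ∀ V W → substV (single V) (renV suc W) ≡ W
substV-single-wk V W = trans (substV-renV (single V) suc W) (substV-var W)

renC-ext-wk-[0] : ∀ N → renC (ext suc) N [ var zero ] ≡ N
renC-ext-wk-[0] N = trans (substC-renC (single (var zero)) (ext suc) N) (trans (substC-cong pointwise N) (substC-var N))
  where
  pointwise : single (var zero) ∘ ext suc ≗ var
  pointwise zero    = refl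
  pointwise (suc n) = refl

SubstClosed : Rel Comp 0ℓ → Set
SubstClosed R = ∀ σ {M N} → R M N → R (substC σ M) (substC σ N)

surf-substC : {R : Rel Comp 0ℓ} → SubstClosed R → SubstClosed (Surf R)
surf-substC closed σ (root r)   = root (closed σ r)
surf-substC closed σ (appR V s) = appR (substV σ V) (surf-substC closed σ s)
surf-substC closed σ (lamL L s) = lamL (substC σ L) (surf-substC closed (exts σ) s)

surf-renC : {R : Rel Comp 0ℓ} → SubstClosed R → ∀ ρ {M N} → Surf R M N → Surf R (renC ρ M) (renC ρ N)
surf-renC closed ρ {M} {N} s =
  subst₂ (Surf _) (sym (renC≡substC ρ M)) (sym (renC≡substC ρ N)) (surf-substC closed (var ∘ ρ) s)

βc-rule-≡ : ∀ {P} M V → P ≡ M [ V ] → βc (app (lam M) (ret V)) P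
βc-rule-≡ M V refl = βc-rule M V

σ-rule-≡ : ∀ {W} N M L → W ≡ renV suc (lam N) → σr (app (lam N) (app (lam M) L)) (app (lam (app W M)) L)
σ-rule-≡ N M L refl = σ-rule N M L

βc-substC : SubstClosed βc
βc-substC σ (βc-rule M V) = βc-rule-≡ _ _ (substC-[] σ M V)

idr-substC : SubstClosed idr
idr-substC σ (id-rule M) = id-rule (substC σ M)

σr-substC : SubstClosed σr
σr-substC σ (σ-rule N M L) = σ-rule-≡ _ _ _ (substV-exts-wk σ (lam N))

record SurfaceCompatible (X : Rel Comp ℓ) : Set ℓ where
  field
    appR-compat : ∀ V {M N} → X M N → X (app V M) (app V N)
    lamL-compat : ∀ L {M N} → X M N → X (app (lam M) L) (app (lam N) L)

open SurfaceCompatible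

surf-compat : {R : Rel Comp 0ℓ} → SurfaceCompatible (Surf R)
surf-compat = record { appR-compat = λ V → appR V ; lamL-compat = λ L → lamL L }

∪-compat : {X Y : Rel Comp ℓ} → SurfaceCompatible X → SurfaceCompatible Y → SurfaceCompatible (X ∪ Y)
∪-compat X Y .appR-compat V = Sum.[ inj₁ ∘ appR-compat X V , inj₂ ∘ appR-compat Y V ]
∪-compat X Y .lamL-compat L = Sum.[ inj₁ ∘ lamL-compat X L , inj₂ ∘ lamL-compat Y L ]

star-compat : {X : Rel Comp ℓ} → SurfaceCompatible X → SurfaceCompatible (Star X)
star-compat X .appR-compat V = Star.gmap (app V) (appR-compat X V)
star-compat X .lamL-compat L = Star.gmap (λ M → app (lam M) L) (lamL-compat X L)

refl-compat : {X : Rel Comp ℓ} → SurfaceCompatible X → SurfaceCompatible (ReflClosure X)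
refl-compat X .appR-compat V = Refl.map (appR-compat X V)
refl-compat X .lamL-compat L = Refl.map (lamL-compat X L)

-- Two surface steps either overlap at the root or lie in disjoint positions
-- (the function and the argument of (λx.M)L), where they trivially commute.
module RootPeaks {R S X Y : Rel Comp 0ℓ}
  (X-compat : SurfaceCompatible X) (Y-compat : SurfaceCompatible Y)
  (S⊆X : Surf S ⇒ X) (R⊆Y : Surf R ⇒ Y)
  (root-left : ∀ {M A B} → R M A → Surf S M B → Joinable X Y A B)
  (root-right : ∀ {M A B} → Surf R M A → S M B → Joinable X Y A B) where

  surface-peak : ∀ {M A B} → Surf R M A → Surf S M B → Joinable X Y A B
  surface-peak (root r)        s               = root-left r s
  surface-peak r@(appR _ _)    (root s)        = root-right r s
  surface-peak r@(lamL _ _)    (root s)        = root-right r s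
  surface-peak (appR V r)      (appR .V s)     =
    let _ , x , y = surface-peak r s in -, appR-compat X-compat V x , appR-compat Y-compat V y
  surface-peak (lamL L r)      (lamL .L s)     =
    let _ , x , y = surface-peak r s in -, lamL-compat X-compat L x , lamL-compat Y-compat L y
  surface-peak (appR _ r)      (lamL _ s)      = -, S⊆X (lamL _ s) , R⊆Y (appR _ r)
  surface-peak (lamL _ r)      (appR _ s)      = -, S⊆X (appR _ s) , R⊆Y (lamL _ r)

Sβ Sid Sσ Sβid : Rel Comp 0ℓ
Sβ   = Surf βc
Sid  = Surf idr
Sσ   = Surf σr
Sβid = Sβ ∪ Sid

peak-βc-Sβ : ∀ {M A B} → βc M A → Sβ M B → Joinable (ReflClosure Sβ) (ReflClosure Sβ) A B
peak-βc-Sβ (βc-rule M V) (root (βc-rule .M .V)) = -, Refl.refl , Refl.refl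
peak-βc-Sβ (βc-rule M V) (appR _ (root ()))
peak-βc-Sβ (βc-rule M V) (lamL _ s)              =
  -, Refl.[ surf-substC βc-substC (single V) s ] , Refl.[ root (βc-rule _ V) ]

peak-idr-Sid : ∀ {M A B} → idr M A → Sid M B → Joinable (ReflClosure Sid) (ReflClosure Sid) A B
peak-idr-Sid (id-rule M) (root (id-rule .M)) = -, Refl.refl , Refl.refl
peak-idr-Sid (id-rule M) (appR _ s)          = -, Refl.[ s ] , Refl.[ root (id-rule _) ]
peak-idr-Sid (id-rule M) (lamL _ (root ()))

peak-idr-Sβ : ∀ {M A B} → idr M A → Sβ M B → Joinable (ReflClosure Sβ) (ReflClosure Sid) A B
peak-idr-Sβ (id-rule _) (root (βc-rule _ _)) = -, Refl.refl , Refl.refl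
peak-idr-Sβ (id-rule M) (appR _ s)           = -, Refl.[ s ] , Refl.[ root (id-rule _) ]
peak-idr-Sβ (id-rule M) (lamL _ (root ()))

peak-Sid-βc : ∀ {M A B} → Sid M A → βc M B → Joinable (ReflClosure Sβ) (ReflClosure Sid) A B
peak-Sid-βc (root (id-rule _)) (βc-rule _ _)  = -, Refl.refl , Refl.refl
peak-Sid-βc (appR _ (root ())) (βc-rule _ _)
peak-Sid-βc (lamL _ s)         (βc-rule M V) =
  -, Refl.[ root (βc-rule _ V) ] , Refl.[ surf-substC idr-substC (single V) s ]

peak-σr-Sσ : ∀ {M A B} → σr M A → Sσ M B → Joinable (Star Sσ) (Star Sσ) A B
peak-σr-Sσ (σ-rule N M L) (root (σ-rule .N .M .L)) = -, ε , ε
peak-σr-Sσ (σ-rule N M _) (appR _ (root (σ-rule .M P Q))) =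
  -, return (root (σ-rule-≡ _ _ _ (cong (λ W → lam (app W (renC (ext suc) M))) (sym (renV-ext-wk suc (lam N))))))
   , root (σ-rule _ _ _) ◅ lamL _ (root (σ-rule _ _ _)) ◅ ε
peak-σr-Sσ (σ-rule N M L) (appR _ (appR _ s)) = -, return (appR _ s) , return (root (σ-rule _ _ _))
peak-σr-Sσ (σ-rule N M L) (appR _ (lamL _ s)) = -, return (lamL _ (appR _ s)) , return (root (σ-rule _ _ _))
peak-σr-Sσ (σ-rule N M L) (lamL _ s)          =
  -, return (lamL _ (lamL _ (surf-renC σr-substC (ext suc) s))) , return (root (σ-rule _ _ _))

peak-σr-Sβ : ∀ {M A B} → σr M A → Sβ M B → Joinable (ReflClosure Sβ) (ReflClosure Sσ) A B
peak-σr-Sβ (σ-rule N M L) (root ())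
peak-σr-Sβ (σ-rule N M _) (appR _ (root (βc-rule .M V))) =
  -, Refl.[ root (βc-rule-≡ _ _ (cong (λ W → app W (M [ V ])) (sym (substV-single-wk V (lam N))))) ] , Refl.refl
peak-σr-Sβ (σ-rule N M L) (appR _ (appR _ s)) = -, Refl.[ appR _ s ] , Refl.[ root (σ-rule _ _ _) ]
peak-σr-Sβ (σ-rule N M L) (appR _ (lamL _ s)) = -, Refl.[ lamL _ (appR _ s) ] , Refl.[ root (σ-rule _ _ _) ]
peak-σr-Sβ (σ-rule N M L) (lamL _ s)          =
  -, Refl.[ lamL _ (lamL _ (surf-renC βc-substC (ext suc) s)) ] , Refl.[ root (σ-rule _ _ _) ]

peak-Sσ-βc : ∀ {M A B} → Sσ M A → βc M B → Joinable (ReflClosure Sβ) (ReflClosure Sσ) A B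
peak-Sσ-βc (root ())         (βc-rule _ _)
peak-Sσ-βc (appR _ (root ())) (βc-rule _ _)
peak-Sσ-βc (lamL _ s)        (βc-rule M V) =
  -, Refl.[ root (βc-rule _ V) ] , Refl.[ surf-substC σr-substC (single V) s ]

peak-σr-Sid : ∀ {M A B} → σr M A → Sid M B → Joinable (Star Sβid) (ReflClosure Sσ) A B
peak-σr-Sid (σ-rule _ M L) (root (id-rule _))            = -, return (inj₂ (lamL L (root (id-rule M)))) , Refl.refl
peak-σr-Sid (σ-rule N _ _) (appR _ (root (id-rule L))) =
  -, return (inj₁ (lamL L (root (βc-rule-≡ _ _ (sym (renC-ext-wk-[0] N)))))) , Refl.refl
peak-σr-Sid (σ-rule N M L) (appR _ (appR _ s)) = -, return (inj₂ (appR _ s)) , Refl.[ root (σ-rule _ _ _) ]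
peak-σr-Sid (σ-rule N M L) (appR _ (lamL _ s)) = -, return (inj₂ (lamL _ (appR _ s))) , Refl.[ root (σ-rule _ _ _) ]
peak-σr-Sid (σ-rule N M L) (lamL _ s)          =
  -, return (inj₂ (lamL _ (lamL _ (surf-renC idr-substC (ext suc) s)))) , Refl.[ root (σ-rule _ _ _) ]

peak-Sσ-idr : ∀ {M A B} → Sσ M A → idr M B → Joinable (Star Sβid) (ReflClosure Sσ) A B
peak-Sσ-idr (root (σ-rule _ M L)) (id-rule _) = -, return (inj₂ (lamL L (root (id-rule M)))) , Refl.refl
peak-Sσ-idr (appR _ s)            (id-rule _) = -, return (inj₂ (root (id-rule _))) , Refl.[ s ]
peak-Sσ-idr (lamL _ (root ()))    (id-rule _)

Sβ-strongly-confluent : StronglyCommute Sβ Sβ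
Sβ-strongly-confluent = strongly-commute-from-refl (RootPeaks.surface-peak
  (refl-compat surf-compat) (refl-compat surf-compat) Refl.[_] Refl.[_] peak-βc-Sβ (λ s r → map₂ swap (peak-βc-Sβ r s)))

Sid-strongly-confluent : StronglyCommute Sid Sid
Sid-strongly-confluent = strongly-commute-from-refl (RootPeaks.surface-peak
  (refl-compat surf-compat) (refl-compat surf-compat) Refl.[_] Refl.[_] peak-idr-Sid (λ s r → map₂ swap (peak-idr-Sid r s)))

Sid-Sβ-strongly-commute : StronglyCommute Sid Sβ
Sid-Sβ-strongly-commute = strongly-commute-from-refl (RootPeaks.surface-peak
  (refl-compat surf-compat) (refl-compat surf-compat) Refl.[_] Refl.[_] peak-idr-Sβ peak-Sid-βc)

Sσ-Sβ-strongly-commute : StronglyCommute Sσ Sβ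
Sσ-Sβ-strongly-commute = strongly-commute-from-refl (RootPeaks.surface-peak
  (refl-compat surf-compat) (refl-compat surf-compat) Refl.[_] Refl.[_] peak-σr-Sβ peak-Sσ-βc)

Sσ-Sβid-strongly-commute : StronglyCommute Sσ Sβid
Sσ-Sβid-strongly-commute s (inj₁ b) = map₂ (λ (bs , s⁼) → Star.map inj₁ bs , s⁼) (Sσ-Sβ-strongly-commute s b)
Sσ-Sβid-strongly-commute s (inj₂ i) = RootPeaks.surface-peak
  (star-compat (∪-compat surf-compat surf-compat)) (refl-compat surf-compat)
  (return ∘ inj₂) Refl.[_] peak-σr-Sid peak-Sσ-idr s i

Sσ-weakly-confluent : WeaklyConfluent Sσ
Sσ-weakly-confluent = RootPeaks.surface-peak
  (star-compat surf-compat) (star-compat surf-compat) return return peak-σr-Sσ (λ s r → map₂ swap (peak-σr-Sσ r s))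

mutual
  weightC : Comp → ℕ
  weightC (ret V)   = 1
  weightC (app V M) = weightC M + weightC M + weightV V

  weightV : Val → ℕ
  weightV (var _) = 1
  weightV (lam M) = weightC M

weightC-positive : ∀ M → 1 ≤ weightC M
weightC-positive (ret V)   = ≤-refl
weightC-positive (app V M) =
  ≤-trans (weightC-positive M) (≤-trans (m≤m+n (weightC M) (weightC M)) (m≤m+n (weightC M + weightC M) (weightV V)))

mutual
  weightC-renC : ∀ ρ M → weightC (renC ρ M) ≡ weightC M
  weightC-renC ρ (ret V)   = refl
  weightC-renC ρ (app V M) = cong₂ (λ m v → m + m + v) (weightC-renC ρ M) (weightV-renV ρ V)

  weightV-renV : ∀ ρ V → weightV (renV ρ V) ≡ weightV V
  weightV-renV ρ (var n) = refl
  weightV-renV ρ (lam M) = weightC-renC (ext ρ) M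

σ-regroup : ∀ l m n → (l + l + m) + (l + l + m) + n ≡ (l + l + (m + m + n)) + (l + l)
σ-regroup = solve-∀

-- Arguments count twice, so σ, which takes L out of an argument position, loses 2·weight L.
Sσ-decreases-weight : ∀ {M N} → Sσ M N → weightC N < weightC M
Sσ-decreases-weight (root (σ-rule N M L))
  rewrite weightC-renC (ext suc) N | σ-regroup (weightC L) (weightC M) (weightC N) =
  m<m+n _ (≤-trans (weightC-positive L) (m≤m+n (weightC L) (weightC L)))
Sσ-decreases-weight (appR V s) = +-monoˡ-< (weightV V) (+-mono-< (Sσ-decreases-weight s) (Sσ-decreases-weight s))
Sσ-decreases-weight (lamL L s) = +-monoʳ-< (weightC L + weightC L) (Sσ-decreases-weight s)

Sβ-confluent : Confluent Sβ
Sβ-confluent = strong⇒confluent Sβ-strongly-confluent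

Sid-confluent : Confluent Sid
Sid-confluent = strong⇒confluent Sid-strongly-confluent

Sσ-confluent : Confluent Sσ
Sσ-confluent = sn&wcr⇒cr (measure⇒sn weightC Sσ-decreases-weight) Sσ-weakly-confluent

Sβ∪Sid-confluent : Confluent (Sβ ∪ Sid)
Sβ∪Sid-confluent = hindley-rosen Sβ-confluent Sid-confluent (strong⇒commute Sid-Sβ-strongly-commute)

Sβ∪Sσ-confluent : Confluent (Sβ ∪ Sσ)
Sβ∪Sσ-confluent = hindley-rosen Sβ-confluent Sσ-confluent (strong⇒commute Sσ-Sβ-strongly-commute)

Sβ∪Sσ∪Sid-confluent : Confluent (Sβ ∪ (Sσ ∪ Sid))
Sβ∪Sσ∪Sid-confluent = confluent-transfer
  Sum.[ Sum.[ return ∘ inj₁ , return ∘ inj₂ ∘ inj₂ ] , return ∘ inj₂ ∘ inj₁ ]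
  Sum.[ return ∘ inj₁ ∘ inj₁ , Sum.[ return ∘ inj₂ , return ∘ inj₁ ∘ inj₂ ] ]
  (hindley-rosen Sβ∪Sid-confluent Sσ-confluent (strong⇒commute Sσ-Sβid-strongly-commute))

-- With M₀ = (λx.x(!x))((λx.!x)(!z)), σ and id lead to the distinct normal forms
-- (λx.(λy.y(!y))(!x))(!z) and (λx.x(!x))(!z); only βc could join them.
N₀ M₀ Mσ Mid : Comp
N₀  = app (var zero) (ret (var zero))
M₀  = app (lam N₀) (app (lam (ret (var zero))) (ret (var zero)))
Mσ  = app (lam (app (lam N₀) (ret (var zero)))) (ret (var zero))
Mid = app (lam N₀) (ret (var zero))

N₀-normal : IsNormalForm (Sσ ∪ Sid) N₀
N₀-normal (_ , inj₁ (root ()))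
N₀-normal (_ , inj₁ (appR _ (root ())))
N₀-normal (_ , inj₂ (root ()))
N₀-normal (_ , inj₂ (appR _ (root ())))

Mid-normal : IsNormalForm (Sσ ∪ Sid) Mid
Mid-normal (_ , inj₁ (root ()))
Mid-normal (_ , inj₁ (appR _ (root ())))
Mid-normal (_ , inj₁ (lamL _ s)) = N₀-normal (-, inj₁ s)
Mid-normal (_ , inj₂ (root ()))
Mid-normal (_ , inj₂ (appR _ (root ())))
Mid-normal (_ , inj₂ (lamL _ s)) = N₀-normal (-, inj₂ s)

Mσ-normal : IsNormalForm (Sσ ∪ Sid) Mσ
Mσ-normal (_ , inj₁ (root ()))
Mσ-normal (_ , inj₁ (appR _ (root ())))
Mσ-normal (_ , inj₁ (lamL _ s)) = Mid-normal (-, inj₁ s)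
Mσ-normal (_ , inj₂ (root ()))
Mσ-normal (_ , inj₂ (appR _ (root ())))
Mσ-normal (_ , inj₂ (lamL _ s)) = Mid-normal (-, inj₂ s)

Sσ∪Sid-not-confluent : ¬ Confluent (Sσ ∪ Sid)
Sσ∪Sid-not-confluent conf
  with conf {M₀} (return (inj₁ (root (σ-rule _ _ _)))) (return (inj₂ (appR _ (root (id-rule _)))))
... | _ , s ◅ _ , _     = Mσ-normal (-, s)
... | _ , ε     , s ◅ _ = Mid-normal (-, s)

mainTheorem9 : (Confluent (Surf βc) × Confluent (Surf idr) × Confluent (Surf σr))
    × (Confluent (Surf βc ∪ Surf idr) × Confluent (Surf βc ∪ Surf σr))
    × Confluent (Surf βc ∪ (Surf σr ∪ Surf idr))
    × ¬ Confluent (Surf σr ∪ Surf idr)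
mainTheorem9 = (Sβ-confluent , Sid-confluent , Sσ-confluent)
             , (Sβ∪Sid-confluent , Sβ∪Sσ-confluent)
             , Sβ∪Sσ∪Sid-confluent
             , Sσ∪Sid-not-confluent
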